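{- Let $S\subset\mathbb Z$ be finite and non-empty with diameter $d=\max S-\min S$, and for $n>d$ regard $S$ as a subset of $\mathbb Z_n$ via reduction modulo $n$. Then for every $n>d$, \[ \tau(S,\mathbb Z)\le\frac{\tau(S,\mathbb Z_n)}{n}\le\frac{\tau(S,n)}n,\qquad \kappa(S,\mathbb Z)\le\kappa(S,\mathbb Z_n)\le\kappa(S,n), \] and for every $m\ge1$, $\tau(S,mn-d)\le m\,\tau(S,\mathbb Z_n)$. Furthermore, \[ \lim_{n\to\infty}\frac{\tau(S,\mathbb Z_n)}n=\tau(S,\mathbb Z)=\inf_{n>d}\frac{\tau(S,\mathbb Z_n)}n,\quad \lim_{n\to\infty}\kappa(S,\mathbb Z_n)=\kappa(S,\mathbb Z)=\inf_{n>d}\kappa(S,\mathbb Z_n), \] \[ \lim_{n\to\infty}e(S,\mathbb Z_n)=e(S,\mathbb Z)=\sup_{n>d}e(S,\mathbb Z_n). \]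
   Context: For finite non-empty $S\subset\mathbb Z$ and $N\ge1$: $\tau(S,N)=\min\{|T|:T\subseteq\mathbb Z,\ T+S\supseteq\{1,\dots,N\}\}$, $\kappa(S,N)=\tau(S,N)|S|/N$, $\tau(S,\mathbb Z)=\lim_{N\to\infty}\tau(S,N)/N$ (which exists), $\kappa(S,\mathbb Z)=\tau(S,\mathbb Z)|S|$, $e(S,\mathbb Z)=1/\kappa(S,\mathbb Z)$. For $S\subseteq\mathbb Z_n$: $\tau(S,\mathbb Z_n)=\min\{|T|:T\subseteq\mathbb Z_n,\ T+S=\mathbb Z_n\}$, $\kappa(S,\mathbb Z_n)=\tau(S,\mathbb Z_n)|S|/n$, $e(S,\mathbb Z_n)=1/\kappa(S,\mathbb Z_n)$. -}

module Defs where

open import Data.Nat as ℕ using (ℕ; zero; suc)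
open import Data.Integer as ℤ using (ℤ; +_)
open import Data.Integer.Divisibility as ℤD using ()
open import Data.Fin using (Fin; toℕ)
open import Data.List using (List; _∷_; []; length; foldr)
open import Data.List.Membership.Propositional using (_∈_)
open import Data.List.Relation.Unary.Unique.Propositional using (Unique)
open import Data.Product using (Σ; ∃; _×_; _,_)
open import Data.Rational as ℚ using (ℚ; 0ℚ)
open import Relation.Binary.PropositionalEquality using (_≡_)

record FinSetℤ : Set where
  constructor mkSet
  field
    elems  : List ℤ
    unique : Unique elems
    nonempty : ∃ λ x → x ∈ elems
open FinSetℤ public

card : FinSetℤ → ℕ
card S = length (elems S)

maxL minL : ℤ → List ℤ → ℤ
maxL = foldr ℤ._⊔_
minL = foldr ℤ._⊓_

diam : FinSetℤ → ℕ
diam S with elems S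
... | [] = 0
... | x ∷ xs = ℤ.∣ maxL x xs ℤ.- minL x xs ∣

-- rational a / b (only used with b ≥ 1; value 0 for b = 0)
_//_ : ℕ → ℕ → ℚ
a // zero = 0ℚ
a // suc b = (+ a) ℚ./ suc b

CoversInterval : FinSetℤ → ℕ → List ℤ → Set
CoversInterval S N T =
  (x : ℤ) → + 1 ℤ.≤ x → x ℤ.≤ + N →
  Σ ℤ λ t → Σ ℤ λ s → t ∈ T × s ∈ elems S × t ℤ.+ s ≡ x

IsTauN : FinSetℤ → ℕ → ℕ → Set
IsTauN S N t =
  (Σ (List ℤ) λ T → Unique T × CoversInterval S N T × length T ≡ t)
  × ((T : List ℤ) → Unique T → CoversInterval S N T → t ℕ.≤ length T)

-- T + (S mod n) = ℤ_n, T ⊆ ℤ_n (elements of ℤ_n represented by Fin n)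
CoversZn : FinSetℤ → (n : ℕ) → List (Fin n) → Set
CoversZn S n T =
  (x : Fin n) →
  Σ (Fin n) λ t → Σ ℤ λ s → t ∈ T × s ∈ elems S ×
    (+ n) ℤD.∣ ((+ toℕ t) ℤ.+ s ℤ.- (+ toℕ x))

IsTauZn : FinSetℤ → (n : ℕ) → ℕ → Set
IsTauZn S n t =
  (Σ (List (Fin n)) λ T → Unique T × CoversZn S n T × length T ≡ t)
  × ((T : List (Fin n)) → Unique T → CoversZn S n T → t ℕ.≤ length T)

LimLe : (ℕ → ℚ) → ℚ → Set
LimLe b q = (ε : ℚ) → 0ℚ ℚ.< ε →
  Σ ℕ λ M → (N : ℕ) → M ℕ.≤ N → b N ℚ.≤ q ℚ.+ ε

LimGe : (ℕ → ℚ) → ℚ → Set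
LimGe b q = (ε : ℚ) → 0ℚ ℚ.< ε →
  Σ ℕ λ M → (N : ℕ) → M ℕ.≤ N → q ℚ.≤ b N ℚ.+ ε

-- lim_{n→∞} a n = lim_{N→∞} b N  (both limits exist and are equal)
SameLim : (ℕ → ℚ) → (ℕ → ℚ) → Set
SameLim a b = (ε : ℚ) → 0ℚ ℚ.< ε →
  Σ ℕ λ M → (n N : ℕ) → M ℕ.≤ n → M ℕ.≤ N → ℚ.∣ a n ℚ.- b N ∣ ℚ.< ε

-- lim b = inf_{n>d} a n, given a n ≥ lim b for all n > d:
-- for every ε > 0 some n > d has a n < lim b + ε
InfApprox : ℕ → (ℕ → ℚ) → (ℕ → ℚ) → Set
InfApprox d a b = (ε : ℚ) → 0ℚ ℚ.< ε →
  Σ ℕ λ n → d ℕ.< n × Σ ℕ λ M → (N : ℕ) → M ℕ.≤ N → a n ℚ.< b N ℚ.+ ε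

-- lim b = sup_{n>d} a n, given a n ≤ lim b for all n > d:
-- for every ε > 0 some n > d has lim b < a n + ε
SupApprox : ℕ → (ℕ → ℚ) → (ℕ → ℚ) → Set
SupApprox d a b = (ε : ℚ) → 0ℚ ℚ.< ε →
  Σ ℕ λ n → d ℕ.< n × Σ ℕ λ M → (N : ℕ) → M ℕ.≤ N → b N ℚ.< a n ℚ.+ ε

-- τ(N) = τ(S, N) is subadditive (covers of [1, N] and [1, L] combine) and superadditive up to the
-- diameter d (a cover of [1, N + L], cut at N - min S, yields covers of [1, N] and of a translate of
-- [1, L] sharing at most d points), which forces τ(N)/N to converge with explicit error terms.
-- A cover of [1, n] reduces modulo n to a cover of ℤ_n, and a cover of ℤ_n lifts to a cover of
-- [1, m n - d] of m times its size, so τ(m n - d) ≤ m τ(S, ℤ_n). For large m this bounds lim τ(N)/N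
-- by τ(S, ℤ_n)/n; for m = 1 it bounds τ(S, ℤ_n)/n below by τ(n - d)/n, which tends to the same limit.
-- Multiplying by |S| gives the statements for κ. Since κ(S, N) ≥ 1 and κ(S, ℤ_n) ≥ (n - d)/n ≥ 1/2
-- for n ≥ 2d, inverting changes errors by at most a constant factor, which gives those for e.

module Submission where

open import Defs
open import Data.Nat as ℕ using (ℕ; zero; suc; pred; z≤n; s≤s; _+_; _*_; _∸_; _≤_; _<_)
import Data.Nat.Properties as ℕP
import Data.Nat.DivMod as ℕDM
import Data.Nat.Divisibility as ℕD
open import Data.Integer as ℤ using (ℤ; +_; -[1+_])
  renaming (_+_ to _+ᶻ_; _-_ to _-ᶻ_; _*_ to _*ᶻ_; _≤_ to _≤ᶻ_; _<_ to _<ᶻ_)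
import Data.Integer.Properties as ℤP
import Data.Integer.DivMod as ℤDM
import Data.Integer.Divisibility as ℤD
import Data.Integer.Divisibility.Signed as ℤS
open import Data.Integer.Tactic.RingSolver using (solve-∀; solve)
import Data.Nat.Tactic.RingSolver as ℕ-Solver
open import Data.Rational as ℚ using (ℚ; mkℚ; 0ℚ)
  renaming (_≤_ to _≤ℚ_; _<_ to _<ℚ_; _+_ to _+ℚ_; _-_ to _-ℚ_)
import Data.Rational.Properties as ℚP
open import Data.Rational.Unnormalised as ℚᵘ using (ℚᵘ; mkℚᵘ; *≤*; *<*)
import Data.Rational.Unnormalised.Properties as ℚᵘP
open import Data.Rational.Solver using (module +-*-Solver)
open import Data.Fin using (Fin; toℕ; fromℕ<)
import Data.Fin.Properties as FinP
open import Data.List using (List; []; _∷_; length; map; filter; _++_; concatMap; upTo; deduplicate)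
import Data.List.Properties as ListP
open import Data.List.Membership.Propositional using (_∈_)
import Data.List.Membership.Propositional.Properties as ∈P
open import Data.List.Relation.Unary.Any as Any using (here; there; _─_)
import Data.List.Relation.Unary.All as All
import Data.List.Relation.Unary.AllPairs as AllPairs
open import Data.List.Relation.Unary.Unique.Propositional using (Unique)
import Data.List.Relation.Unary.Unique.Propositional.Properties as UniqueP
import Data.List.Relation.Unary.Unique.DecPropositional.Properties as UniqueDecP
open import Data.List.Relation.Binary.Subset.Propositional using (_⊆_)
open import Data.Product using (Σ; ∃; _×_; _,_; proj₁; proj₂)
open import Data.Sum using (_⊎_; inj₁; inj₂)
open import Data.Empty using (⊥-elim)
open import Function using (_∘_)
open import Relation.Nullary using (Dec; yes; no; _×-dec_)
open import Relation.Binary.PropositionalEquality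

private variable
  A B C : Set

∈-─ : ∀ {x z : A} {ys} (p : x ∈ ys) → z ∈ ys → z ≢ x → z ∈ (ys ─ p)
∈-─ (here refl) (here refl) z≢x = ⊥-elim (z≢x refl)
∈-─ (here refl) (there q)   _   = q
∈-─ (there p)   (here refl) _   = here refl
∈-─ (there p)   (there q)   z≢x = there (∈-─ p q z≢x)

Unique⇒length≤ : ∀ {xs ys : List A} → Unique xs → xs ⊆ ys → length xs ≤ length ys
Unique⇒length≤ {xs = []} _ _ = z≤n
Unique⇒length≤ {xs = x ∷ xs} {ys} (x∉xs AllPairs.∷ u) xs⊆ys =
  subst (suc (length xs) ≤_) (sym (ListP.length-removeAt′ ys (Any.index x∈ys)))
    (s≤s (Unique⇒length≤ u λ z∈xs →
      ∈-─ x∈ys (xs⊆ys (there z∈xs)) λ z≡x → All.lookup x∉xs z∈xs (sym z≡x)))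
  where x∈ys = xs⊆ys (here refl)

length-filter-∪ : ∀ {P Q : A → Set} (P? : ∀ x → Dec (P x)) (Q? : ∀ x → Dec (Q x)) →
  (∀ x → P x ⊎ Q x) → (xs : List A) →
  length (filter P? xs) + length (filter Q? xs) ≤ length xs + length (filter (λ x → P? x ×-dec Q? x) xs)
length-filter-∪ P? Q? P∪Q [] = z≤n
length-filter-∪ P? Q? P∪Q (x ∷ xs) with ih ← length-filter-∪ P? Q? P∪Q xs | P? x | Q? x
... | yes _ | yes _ =
  s≤s (ℕP.≤-trans (ℕP.≤-reflexive (ℕP.+-suc _ _)) (ℕP.≤-trans (s≤s ih) (ℕP.≤-reflexive (sym (ℕP.+-suc _ _)))))
... | yes _ | no _  = s≤s ih
... | no _  | yes _ = ℕP.≤-trans (ℕP.≤-reflexive (ℕP.+-suc _ _)) (s≤s ih)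
... | no ¬p | no ¬q with P∪Q x
...   | inj₁ p = ⊥-elim (¬p p)
...   | inj₂ q = ⊥-elim (¬q q)

length-concatMap-map : ∀ (f : A → B → C) ys (xs : List A) →
  length (concatMap (λ x → map (f x) ys) xs) ≡ length xs * length ys
length-concatMap-map f ys [] = refl
length-concatMap-map f ys (x ∷ xs) =
  trans (ListP.length-++ (map (f x) ys)) (cong₂ _+_ (ListP.length-map (f x) ys) (length-concatMap-map f ys xs))

≤⇒≡+ : ∀ {x y} → x ≤ᶻ y → ∃ λ k → y ≡ x +ᶻ + k
≤⇒≡+ {x} {y} x≤y = ℤ.∣ y -ᶻ x ∣ , (begin
  y                        ≡⟨ solve (x ∷ y ∷ []) ⟩
  x +ᶻ (y -ᶻ x)            ≡⟨ cong (x +ᶻ_) (sym (ℤP.0≤i⇒+∣i∣≡i (ℤP.i≤j⇒0≤j-i x≤y))) ⟩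
  x +ᶻ + ℤ.∣ y -ᶻ x ∣      ∎)
  where open ≡-Reasoning

-b+[b+x]≡x : ∀ b x → ℤ.- b +ᶻ (b +ᶻ x) ≡ x
-b+[b+x]≡x = solve-∀

+-cancelˡ-≡ᶻ : ∀ b {x y} → b +ᶻ x ≡ b +ᶻ y → x ≡ y
+-cancelˡ-≡ᶻ b {x} {y} eq = trans (sym (-b+[b+x]≡x b x)) (trans (cong (ℤ.- b +ᶻ_) eq) (-b+[b+x]≡x b y))

+-cancelˡ-<ᶻ : ∀ b {x y} → b +ᶻ x <ᶻ b +ᶻ y → x <ᶻ y
+-cancelˡ-<ᶻ b {x} {y} lt = subst₂ _<ᶻ_ (-b+[b+x]≡x b x) (-b+[b+x]≡x b y) (ℤP.+-monoʳ-< (ℤ.- b) lt)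

interval : ℤ → ℕ → List ℤ
interval b n = map (λ i → b +ᶻ + i) (upTo n)

length-interval : ∀ b n → length (interval b n) ≡ n
length-interval b n = trans (ListP.length-map _ (upTo n)) (ListP.length-upTo n)

interval-unique : ∀ b n → Unique (interval b n)
interval-unique b n = UniqueP.map⁺ (ℤP.+-injective ∘ +-cancelˡ-≡ᶻ b) (UniqueP.upTo⁺ n)

∈-interval⁺ : ∀ {b n t} → b ≤ᶻ t → t <ᶻ b +ᶻ + n → t ∈ interval b n
∈-interval⁺ {b} {n} b≤t t<b+n with k , refl ← ≤⇒≡+ b≤t =
  ∈P.∈-map⁺ (λ i → b +ᶻ + i) (∈P.∈-upTo⁺ (ℤP.drop‿+<+ (+-cancelˡ-<ᶻ b t<b+n)))

∈-interval⁻ : ∀ {b n t} → t ∈ interval b n → b ≤ᶻ t × t <ᶻ b +ᶻ + n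
∈-interval⁻ {b} t∈ with i , i∈ , refl ← ∈P.∈-map⁻ (λ i → b +ᶻ + i) t∈ =
  ℤP.i≤i+j b (+ i) , ℤP.+-monoʳ-< b (ℤ.+<+ (∈P.∈-upTo⁻ i∈))

a+b-b≡a : ∀ a b → a +ᶻ b -ᶻ b ≡ a
a+b-b≡a = solve-∀

+≡⇒≡- : ∀ {t s x} → t +ᶻ s ≡ x → t ≡ x -ᶻ s
+≡⇒≡- {t} {s} refl = sym (a+b-b≡a t s)

+-≤⇒≤- : ∀ c {a b} → a +ᶻ c ≤ᶻ b → a ≤ᶻ b -ᶻ c
+-≤⇒≤- c {a} {b} a+c≤b = subst (_≤ᶻ b -ᶻ c) (a+b-b≡a a c) (ℤP.+-monoˡ-≤ (ℤ.- c) a+c≤b)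

≤+⇒-≤ : ∀ c {a b} → a ≤ᶻ b +ᶻ c → a -ᶻ c ≤ᶻ b
≤+⇒-≤ c {a} {b} a≤b+c = subst (a -ᶻ c ≤ᶻ_) (a+b-b≡a b c) (ℤP.+-monoˡ-≤ (ℤ.- c) a≤b+c)

infix 4 _≡_[mod_]

-- A record rather than a definition, so that x, y and n can be inferred from a proof.
record _≡_[mod_] (x y : ℤ) (n : ℕ) : Set where
  constructor mod-by
  field divides : (+ n) ℤS.∣ (x -ᶻ y)

module _ {n : ℕ} where

  ≡[mod]-via : ∀ {x y z} → (+ n) ℤS.∣ z → z ≡ x -ᶻ y → x ≡ y [mod n ]
  ≡[mod]-via n∣z refl = mod-by n∣z

  ≡[mod]-refl : ∀ {x} → x ≡ x [mod n ]
  ≡[mod]-refl {x} = ≡[mod]-via (ℤS.∣n⇒∣m*n (+ 0) ℤS.∣-refl) (sym (ℤP.+-inverseʳ x))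

  ≡[mod]-sym : ∀ {x y} → x ≡ y [mod n ] → y ≡ x [mod n ]
  ≡[mod]-sym {x} {y} (mod-by n∣x-y) = ≡[mod]-via (ℤS.∣m⇒∣-m n∣x-y) (identity x y)
    where
    identity : ∀ x y → ℤ.- (x -ᶻ y) ≡ y -ᶻ x
    identity = solve-∀

  ≡[mod]-trans : ∀ {x y z} → x ≡ y [mod n ] → y ≡ z [mod n ] → x ≡ z [mod n ]
  ≡[mod]-trans {x} {y} {z} (mod-by n∣x-y) (mod-by n∣y-z) = ≡[mod]-via (ℤS.∣m∣n⇒∣m+n n∣x-y n∣y-z) (identity x y z)
    where
    identity : ∀ x y z → x -ᶻ y +ᶻ (y -ᶻ z) ≡ x -ᶻ z
    identity = solve-∀

  ≡[mod]-+ : ∀ {a b c e} → a ≡ b [mod n ] → c ≡ e [mod n ] → a +ᶻ c ≡ b +ᶻ e [mod n ]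
  ≡[mod]-+ {a} {b} {c} {e} (mod-by n∣a-b) (mod-by n∣c-e) = ≡[mod]-via (ℤS.∣m∣n⇒∣m+n n∣a-b n∣c-e) (identity a b c e)
    where
    identity : ∀ a b c e → a -ᶻ b +ᶻ (c -ᶻ e) ≡ a +ᶻ c -ᶻ (b +ᶻ e)
    identity = solve-∀

  ≡[mod]⇒∣ᵤ : ∀ {x y} → x ≡ y [mod n ] → (+ n) ℤD.∣ (x -ᶻ y)
  ≡[mod]⇒∣ᵤ (mod-by n∣x-y) = ℤS.∣⇒∣ᵤ n∣x-y

  ∣ᵤ⇒≡[mod] : ∀ x y → (+ n) ℤD.∣ (x -ᶻ y) → x ≡ y [mod n ]
  ∣ᵤ⇒≡[mod] x y n∣x-y = mod-by (ℤS.∣ᵤ⇒∣ n∣x-y)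

  %ℕ-≡[mod] : .{{_ : ℕ.NonZero n}} → ∀ x → + (x ℤ.%ℕ n) ≡ x [mod n ]
  %ℕ-≡[mod] x = ≡[mod]-via (ℤS.divides (ℤ.- q) refl) (begin
      ℤ.- q *ᶻ + n               ≡⟨ identity r q (+ n) ⟩
      r -ᶻ (r +ᶻ q *ᶻ + n)       ≡⟨ cong (r -ᶻ_) (sym (ℤDM.a≡a%ℕn+[a/ℕn]*n x n)) ⟩
      r -ᶻ x                     ∎)
    where
    open ≡-Reasoning
    r q : ℤ
    r = + (x ℤ.%ℕ n)
    q = x ℤ./ℕ n
    identity : ∀ r q n → ℤ.- q *ᶻ n ≡ r -ᶻ (r +ᶻ q *ᶻ n)
    identity = solve-∀

  ≡[mod]⇒≡ : ∀ {a b} → a < n → b < n → + a ≡ + b [mod n ] → a ≡ b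
  ≡[mod]⇒≡ {a} {b} a<n b<n (mod-by n∣a-b) with ℤ.∣ + a -ᶻ + b ∣ in eq
  ... | zero  = ℤP.+-injective (ℤP.i-j≡0⇒i≡j (+ a) (+ b) (ℤP.∣i∣≡0⇒i≡0 eq))
  ... | suc k = ⊥-elim (ℕP.<-irrefl refl (ℕP.<-≤-trans k<n (ℕD.∣⇒≤ (subst (n ℕD.∣_) eq (ℤS.∣⇒∣ᵤ n∣a-b)))))
    where
    k<n : suc k < n
    k<n = ℕP.≤-<-trans (ℕP.≤-reflexive (trans (sym eq) (cong ℤ.∣_∣ (ℤP.m-n≡m⊖n a b))))
            (ℕP.≤-<-trans (ℤP.∣m⊝n∣≤m⊔n a b) (ℕP.⊔-lub a<n b<n))

-- progression c n w j, for j < m, enumerates the integers of [c, c + m n) congruent to w modulo n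
progression : ℤ → (n : ℕ) .{{_ : ℕ.NonZero n}} → ℤ → ℕ → ℤ
progression c n w j = c +ᶻ + ((w -ᶻ c) ℤ.%ℕ n + j * n)

∈-progression : ∀ {c n m w y} .{{_ : ℕ.NonZero n}} → c ≤ᶻ y → y <ᶻ c +ᶻ + (m * n) →
  y ≡ w [mod n ] → y ∈ map (progression c n w) (upTo m)
∈-progression {c} {n} {m} {w} c≤y y<c+mn y≡w with u , refl ← ≤⇒≡+ c≤y =
  subst (_∈ map (progression c n w) (upTo m))
    (trans (cong (λ r → c +ᶻ + (r + u ℕ./ n * n)) (sym residue)) (cong (λ v → c +ᶻ + v) (sym (ℕDM.m≡m%n+[m/n]*n u n))))
    (∈P.∈-map⁺ (progression c n w) (∈P.∈-upTo⁺ (ℕDM.m<n*o⇒m/o<n (ℤP.drop‿+<+ (+-cancelˡ-<ᶻ c y<c+mn)))))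
  where
  u≡w-c : + u ≡ w -ᶻ c [mod n ]
  u≡w-c = subst (λ v → v ≡ w -ᶻ c [mod n ]) (trans (ℤP.+-comm (c +ᶻ + u) (ℤ.- c)) (-b+[b+x]≡x c (+ u)))
            (≡[mod]-+ y≡w (≡[mod]-refl {x = ℤ.- c}))
  residue : u ℕ.% n ≡ (w -ᶻ c) ℤ.%ℕ n
  residue = ≡[mod]⇒≡ (ℕDM.m%n<n u n) (ℤDM.n%ℕd<d (w -ᶻ c) n)
    (≡[mod]-trans (%ℕ-≡[mod] (+ u))
      (≡[mod]-trans u≡w-c (≡[mod]-sym (%ℕ-≡[mod] (w -ᶻ c)))))

minL≤ : ∀ x xs {s} → s ∈ x ∷ xs → minL x xs ≤ᶻ s
minL≤ x []       (here refl)         = ℤP.≤-refl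
minL≤ x (y ∷ ys) (here refl)         = ℤP.≤-trans (ℤP.i⊓j≤j y (minL x ys)) (minL≤ x ys (here refl))
minL≤ x (y ∷ ys) (there (here refl)) = ℤP.i⊓j≤i y (minL x ys)
minL≤ x (y ∷ ys) (there (there s∈))  = ℤP.≤-trans (ℤP.i⊓j≤j y (minL x ys)) (minL≤ x ys (there s∈))

≤maxL : ∀ x xs {s} → s ∈ x ∷ xs → s ≤ᶻ maxL x xs
≤maxL x []       (here refl)         = ℤP.≤-refl
≤maxL x (y ∷ ys) (here refl)         = ℤP.≤-trans (≤maxL x ys (here refl)) (ℤP.i≤j⊔i y (maxL x ys))
≤maxL x (y ∷ ys) (there (here refl)) = ℤP.i≤i⊔j y (maxL x ys)
≤maxL x (y ∷ ys) (there (there s∈))  = ℤP.≤-trans (≤maxL x ys (there s∈)) (ℤP.i≤j⊔i y (maxL x ys))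

elems-bounded : (S : FinSetℤ) → ∃ λ a → ∀ {s} → s ∈ elems S → a ≤ᶻ s × s ≤ᶻ a +ᶻ + diam S
elems-bounded (mkSet [] _ (_ , ()))
elems-bounded (mkSet (x ∷ xs) _ _) = lo , λ s∈ → minL≤ x xs s∈ , ℤP.≤-trans (≤maxL x xs s∈) (ℤP.≤-reflexive hi≡)
  where
  lo hi : ℤ
  lo = minL x xs
  hi = maxL x xs
  hi≡ : hi ≡ lo +ᶻ + ℤ.∣ hi -ᶻ lo ∣
  hi≡ = proj₂ (≤⇒≡+ (ℤP.≤-trans (minL≤ x xs (here refl)) (≤maxL x xs (here refl))))

IntervalCover : FinSetℤ → ℤ → ℤ → List ℤ → Set
IntervalCover S lo hi T = (x : ℤ) → lo ≤ᶻ x → x ≤ᶻ hi →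
  Σ ℤ λ t → Σ ℤ λ s → t ∈ T × s ∈ elems S × t +ᶻ s ≡ x

module IntervalCovers (S : FinSetℤ) where

  cover-⊆ : ∀ {lo hi T T′} → T ⊆ T′ → IntervalCover S lo hi T → IntervalCover S lo hi T′
  cover-⊆ T⊆T′ cover x lo≤x x≤hi with t , s , t∈ , s∈ , t+s≡x ← cover x lo≤x x≤hi =
    t , s , T⊆T′ t∈ , s∈ , t+s≡x

  cover-restrict : ∀ {lo hi lo′ hi′ T} → lo ≤ᶻ lo′ → hi′ ≤ᶻ hi →
    IntervalCover S lo hi T → IntervalCover S lo′ hi′ T
  cover-restrict lo≤lo′ hi′≤hi cover x lo′≤x x≤hi′ =
    cover x (ℤP.≤-trans lo≤lo′ lo′≤x) (ℤP.≤-trans x≤hi′ hi′≤hi)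

  cover-shift : ∀ {lo hi T} c → IntervalCover S lo hi T →
    IntervalCover S (lo +ᶻ c) (hi +ᶻ c) (map (_+ᶻ c) T)
  cover-shift c cover x lo+c≤x x≤hi+c
    with t , s , t∈ , s∈ , t+s≡x-c ← cover (x -ᶻ c) (+-≤⇒≤- c lo+c≤x) (≤+⇒-≤ c x≤hi+c) =
    t +ᶻ c , s , ∈P.∈-map⁺ (_+ᶻ c) t∈ , s∈ , (begin
      t +ᶻ c +ᶻ s      ≡⟨ solve (t ∷ c ∷ s ∷ []) ⟩
      t +ᶻ s +ᶻ c      ≡⟨ cong (_+ᶻ c) t+s≡x-c ⟩
      x -ᶻ c +ᶻ c      ≡⟨ solve (x ∷ c ∷ []) ⟩
      x                ∎)
    where open ≡-Reasoning

  cover-++ : ∀ {lo m hi T T′} → IntervalCover S lo m T → IntervalCover S (+ 1 +ᶻ m) hi T′ →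
    IntervalCover S lo hi (T ++ T′)
  cover-++ {m = m} {T = T} {T′} cover cover′ x lo≤x x≤hi with x ℤ.≤? m
  ... | yes x≤m = cover-⊆ (∈P.∈-++⁺ˡ {ys = T′}) cover x lo≤x x≤m
  ... | no  x≰m = cover-⊆ (∈P.∈-++⁺ʳ T) cover′ x (ℤP.i<j⇒suc[i]≤j (ℤP.≰⇒> x≰m)) x≤hi

-- The interval covering numbers τ(S, N)

module TauInterval (S : FinSetℤ) (τ : ℕ → ℕ) (isTau : ∀ N → 1 ≤ N → IsTauN S N (τ N)) where

  open IntervalCovers S

  d : ℕ
  d = diam S

  τ-minimal : ∀ {N} → 1 ≤ N → ∀ T → IntervalCover S (+ 1) (+ N) T → τ N ≤ length T
  τ-minimal {N} 1≤N T cover = ℕP.≤-trans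
    (proj₂ (isTau N 1≤N) (deduplicate ℤ._≟_ T) (UniqueDecP.deduplicate-! ℤ._≟_ T)
      (cover-⊆ (∈P.∈-deduplicate⁺ ℤ._≟_) cover))
    (ListP.length-deduplicate ℤ._≟_ T)

  τ-mono : ∀ {N N′} → 1 ≤ N → N ≤ N′ → τ N ≤ τ N′
  τ-mono {N} {N′} 1≤N N≤N′ with T , _ , cover , |T|≡τN′ ← proj₁ (isTau N′ (ℕP.≤-trans 1≤N N≤N′)) =
    subst (τ N ≤_) |T|≡τN′ (τ-minimal 1≤N T (cover-restrict ℤP.≤-refl (ℤ.+≤+ N≤N′) cover))

  τ≤N : ∀ {N} → 1 ≤ N → τ N ≤ N
  τ≤N {N} 1≤N with s , s∈ ← nonempty S =
    subst (τ N ≤_) (trans (ListP.length-map _ (interval (+ 1) N)) (length-interval (+ 1) N))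
      (τ-minimal 1≤N (map (_-ᶻ s) (interval (+ 1) N)) λ x 1≤x x≤N →
        x -ᶻ s , s , ∈P.∈-map⁺ (_-ᶻ s) (∈-interval⁺ 1≤x (ℤP.suc[i]≤j⇒i<j (ℤP.suc-mono x≤N))) , s∈ ,
        solve (x ∷ s ∷ []))

  N≤τ*card : ∀ {N} → 1 ≤ N → N ≤ τ N * card S
  N≤τ*card {N} 1≤N with T , _ , cover , |T|≡τN ← proj₁ (isTau N 1≤N) =
    subst₂ _≤_ (length-interval (+ 1) N) (trans (length-concatMap-map _+ᶻ_ (elems S) T) (cong (_* card S) |T|≡τN))
      (Unique⇒length≤ (interval-unique (+ 1) N) λ x∈ →
        let 1≤x , x<1+N = ∈-interval⁻ x∈
            t , s , t∈ , s∈ , t+s≡x = cover _ 1≤x (ℤP.i<j⇒i≤pred[j] x<1+N)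
        in ∈P.∈-concatMap⁺ (λ t → map (t +ᶻ_) (elems S))
             (Any.map (λ { refl → subst (_∈ map (t +ᶻ_) (elems S)) t+s≡x (∈P.∈-map⁺ (t +ᶻ_) s∈) }) t∈))

  τ-subadditive : ∀ {N L} → 1 ≤ N → 1 ≤ L → τ (N + L) ≤ τ N + τ L
  τ-subadditive {N} {L} 1≤N 1≤L
    with T , _ , cover , |T|≡τN ← proj₁ (isTau N 1≤N) | T′ , _ , cover′ , |T′|≡τL ← proj₁ (isTau L 1≤L) =
    subst (τ (N + L) ≤_) |T++T′|≡ (τ-minimal (ℕP.≤-trans 1≤N (ℕP.m≤m+n N L)) (T ++ map (_+ᶻ + N) T′)
      (cover-++ cover (cover-restrict ℤP.≤-refl (ℤ.+≤+ (ℕP.≤-reflexive (ℕP.+-comm N L))) (cover-shift (+ N) cover′))))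
    where
    |T++T′|≡ : length (T ++ map (_+ᶻ + N) T′) ≡ τ N + τ L
    |T++T′|≡ = trans (ListP.length-++ T) (cong₂ _+_ |T|≡τN (trans (ListP.length-map _ T′) |T′|≡τL))

  τ-superadditive : ∀ {N L} → 1 ≤ N → 1 ≤ L → τ N + τ L ≤ τ (N + L) + d
  τ-superadditive {N} {L} 1≤N 1≤L with T , unique , cover , |T|≡ ← proj₁ (isTau (N + L) (ℕP.≤-trans 1≤N (ℕP.m≤m+n N L)))
                                    | a , a≤s≤a+d ← elems-bounded S = begin
      τ N + τ L                               ≤⟨ ℕP.+-mono-≤ (τ-minimal 1≤N _ low-cover) (τ-minimal 1≤L _ high-cover) ⟩
      length low + length (map (_-ᶻ + N) high) ≡⟨ cong (λ k → length low + k) (ListP.length-map _ high) ⟩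
      length low + length high                ≤⟨ length-filter-∪ Low? High? low∪high T ⟩
      length T + length both                  ≤⟨ ℕP.+-mono-≤ (ℕP.≤-reflexive |T|≡) both≤d ⟩
      τ (N + L) + d                           ∎
    where
    open ℕP.≤-Reasoning
    1≡1+n-n : ∀ n → + 1 ≡ + 1 +ᶻ n -ᶻ n
    1≡1+n-n = solve-∀
    l≡n+l-n : ∀ n l → l ≡ n +ᶻ l -ᶻ n
    l≡n+l-n = solve-∀
    regroup : ∀ n a d → + 1 +ᶻ n -ᶻ (a +ᶻ d) ≡ + 1 +ᶻ (n -ᶻ a -ᶻ d)
    regroup = solve-∀
    1+p≡1+[p-d]+d : ∀ p d → + 1 +ᶻ p ≡ + 1 +ᶻ (p -ᶻ d) +ᶻ d
    1+p≡1+[p-d]+d = solve-∀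
    P : ℤ
    P = + N -ᶻ a
    Low? : ∀ t → Dec (t ≤ᶻ P)
    Low? t = t ℤ.≤? P
    High? : ∀ t → Dec (P -ᶻ + d <ᶻ t)
    High? t = (P -ᶻ + d) ℤ.<? t
    low high both : List ℤ
    low = filter Low? T
    high = filter High? T
    both = filter (λ t → Low? t ×-dec High? t) T
    low∪high : ∀ t → t ≤ᶻ P ⊎ P -ᶻ + d <ᶻ t
    low∪high t with Low? t
    ... | yes t≤P = inj₁ t≤P
    ... | no  t≰P = inj₂ (ℤP.≤-<-trans (ℤP.i-j≤i P (+ d)) (ℤP.≰⇒> t≰P))
    low-cover : IntervalCover S (+ 1) (+ N) low
    low-cover x 1≤x x≤N with t , s , t∈ , s∈ , t+s≡x ← cover x 1≤x (ℤP.≤-trans x≤N (ℤ.+≤+ (ℕP.m≤m+n N L))) =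
      t , s ,
      ∈P.∈-filter⁺ Low? t∈ (subst (_≤ᶻ P) (sym (+≡⇒≡- t+s≡x)) (ℤP.+-mono-≤ x≤N (ℤP.neg-mono-≤ (proj₁ (a≤s≤a+d s∈))))) ,
      s∈ , t+s≡x
    high-cover : IntervalCover S (+ 1) (+ L) (map (_-ᶻ + N) high)
    high-cover = cover-restrict (ℤP.≤-reflexive (sym (1≡1+n-n (+ N)))) (ℤP.≤-reflexive (l≡n+l-n (+ N) (+ L)))
      (cover-shift (ℤ.- + N) shifted)
      where
      shifted : IntervalCover S (+ 1 +ᶻ + N) (+ (N + L)) high
      shifted x 1+N≤x x≤N+L with t , s , t∈ , s∈ , t+s≡x ← cover x (ℤP.≤-trans (ℤ.+≤+ (s≤s z≤n)) 1+N≤x) x≤N+L =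
        t , s , ∈P.∈-filter⁺ High? t∈ (ℤP.suc[i]≤j⇒i<j (subst₂ _≤ᶻ_ (regroup (+ N) a (+ d)) (sym (+≡⇒≡- t+s≡x))
          (ℤP.+-mono-≤ 1+N≤x (ℤP.neg-mono-≤ (proj₂ (a≤s≤a+d s∈)))))) , s∈ , t+s≡x
    both≤d : length both ≤ d
    both≤d = subst (length both ≤_) (length-interval (+ 1 +ᶻ (P -ᶻ + d)) d)
      (Unique⇒length≤ (UniqueP.filter⁺ (λ t → Low? t ×-dec High? t) unique) λ t∈ →
        let _ , t≤P , P-d<t = ∈P.∈-filter⁻ (λ t → Low? t ×-dec High? t) {xs = T} t∈
        in ∈-interval⁺ (ℤP.i<j⇒suc[i]≤j P-d<t)
             (ℤP.suc[i]≤j⇒i<j (ℤP.≤-trans (ℤP.suc-mono t≤P) (ℤP.≤-reflexive (1+p≡1+[p-d]+d P (+ d))))))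

-- The cyclic covering numbers τ(S, ℤ_n)

module TauCyclic (S : FinSetℤ) (τ τₙ : ℕ → ℕ)
  (isTau : ∀ N → 1 ≤ N → IsTauN S N (τ N)) (isTauₙ : ∀ n → diam S < n → IsTauZn S n (τₙ n)) where

  open IntervalCovers S
  open TauInterval S τ isTau

  τₙ-minimal : ∀ {n} → d < n → ∀ T → CoversZn S n T → τₙ n ≤ length T
  τₙ-minimal {n} d<n T cover = ℕP.≤-trans
    (proj₂ (isTauₙ n d<n) (deduplicate FinP._≟_ T) (UniqueDecP.deduplicate-! FinP._≟_ T) λ x →
      let t , s , t∈ , s∈ , t+s≡x = cover x in t , s , ∈P.∈-deduplicate⁺ FinP._≟_ t∈ , s∈ , t+s≡x)
    (ListP.length-deduplicate FinP._≟_ T)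

  -- The class of x ∈ ℤ_n is hit through the integer 1 + x of [1, n].
  τₙ≤τ : ∀ {n} → d < n → τₙ n ≤ τ n
  τₙ≤τ {n@(suc _)} d<n with T , _ , cover , |T|≡τn ← proj₁ (isTau n (s≤s z≤n)) =
    subst (τₙ n ≤_) (trans (ListP.length-map reduce T) |T|≡τn) (τₙ-minimal d<n (map reduce T) reduced-cover)
    where
    reduce : ℤ → Fin n
    reduce t = fromℕ< (ℤDM.n%ℕd<d (t -ᶻ + 1) n)
    reduced-cover : CoversZn S n (map reduce T)
    reduced-cover x with t , s , t∈ , s∈ , t+s≡1+x ← cover (+ 1 +ᶻ + toℕ x) (ℤ.+≤+ (s≤s z≤n)) (ℤ.+≤+ (FinP.toℕ<n x)) =
      reduce t , s , ∈P.∈-map⁺ reduce t∈ , s∈ , ≡[mod]⇒∣ᵤ (subst (λ v → + toℕ (reduce t) +ᶻ s ≡ v [mod n ]) t-1+s≡x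
        (≡[mod]-+ (subst (λ r → + r ≡ t -ᶻ + 1 [mod n ]) (sym (FinP.toℕ-fromℕ< _)) (%ℕ-≡[mod] (t -ᶻ + 1))) ≡[mod]-refl))
      where
      t-1+s≡x : t -ᶻ + 1 +ᶻ s ≡ + toℕ x
      t-1+s≡x = begin
        t -ᶻ + 1 +ᶻ s        ≡⟨ solve (t ∷ s ∷ []) ⟩
        t +ᶻ s -ᶻ + 1        ≡⟨ cong (_-ᶻ + 1) t+s≡1+x ⟩
        + 1 +ᶻ + toℕ x -ᶻ + 1 ≡⟨ 1+y-1≡y (+ toℕ x) ⟩
        + toℕ x              ∎
        where
        open ≡-Reasoning
        1+y-1≡y : ∀ y → + 1 +ᶻ y -ᶻ + 1 ≡ y
        1+y-1≡y = solve-∀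

  -- Lift a cover T of ℤ_n to the m translates by multiples of n of its representatives in
  -- [c, c + n), c = 1 - min S - d; these cover [1, m n - d].
  τ-lift : ∀ {n m} → d < n → 1 ≤ m → τ (m * n ∸ d) ≤ m * τₙ n
  τ-lift {n@(suc _)} {m@(suc _)} d<n _ with T , _ , cover , |T|≡τₙn ← proj₁ (isTauₙ n d<n) | a , a≤s≤a+d ← elems-bounded S =
    subst (τ N ≤_) |lift|≡ (τ-minimal 1≤N lift lift-cover)
    where
    N : ℕ
    N = m * n ∸ d
    d<mn : d < m * n
    d<mn = ℕP.<-≤-trans d<n (ℕP.m≤n*m n m)
    1≤N : 1 ≤ N
    1≤N = ℕP.m<n⇒0<n∸m d<mn
    c : ℤ
    c = + 1 -ᶻ a -ᶻ + d
    lift : List ℤ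
    lift = concatMap (λ t → map (progression c n (+ toℕ t)) (upTo m)) T
    |lift|≡ : length lift ≡ m * τₙ n
    |lift|≡ = trans (length-concatMap-map (λ t → progression c n (+ toℕ t)) (upTo m) T)
      (trans (cong₂ _*_ |T|≡τₙn (ListP.length-upTo m)) (ℕP.*-comm (τₙ n) m))
    c+mn≡1+N-a : c +ᶻ + (m * n) ≡ + 1 +ᶻ (+ N -ᶻ a)
    c+mn≡1+N-a = trans (cong (c +ᶻ_) (cong +_ (sym (ℕP.m∸n+n≡m (ℕP.<⇒≤ d<mn))))) (identity a (+ N) (+ d))
      where
      identity : ∀ a N d → + 1 -ᶻ a -ᶻ d +ᶻ (N +ᶻ d) ≡ + 1 +ᶻ (N -ᶻ a)
      identity = solve-∀
    lift-cover : IntervalCover S (+ 1) (+ N) lift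
    lift-cover x 1≤x x≤N with t , s , t∈ , s∈ , t+s≡x ← cover (fromℕ< (ℤDM.n%ℕd<d x n)) =
      x -ᶻ s , s , ∈P.∈-concatMap⁺ (λ t → map (progression c n (+ toℕ t)) (upTo m)) (Any.map (λ { refl → y∈ }) t∈) ,
      s∈ , solve (x ∷ s ∷ [])
      where
      c≤y : c ≤ᶻ x -ᶻ s
      c≤y = subst (_≤ᶻ x -ᶻ s) (identity a (+ d)) (ℤP.+-mono-≤ 1≤x (ℤP.neg-mono-≤ (proj₂ (a≤s≤a+d s∈))))
        where
        identity : ∀ a d → + 1 -ᶻ (a +ᶻ d) ≡ + 1 -ᶻ a -ᶻ d
        identity = solve-∀
      y<c+mn : x -ᶻ s <ᶻ c +ᶻ + (m * n)
      y<c+mn = subst (x -ᶻ s <ᶻ_) (sym c+mn≡1+N-a)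
        (ℤP.≤-<-trans (ℤP.+-mono-≤ x≤N (ℤP.neg-mono-≤ (proj₁ (a≤s≤a+d s∈)))) (ℤP.suc[i]≤j⇒i<j ℤP.≤-refl))
      y≡t : x -ᶻ s ≡ + toℕ t [mod n ]
      y≡t = ≡[mod]-sym (subst (λ v → v ≡ x -ᶻ s [mod n ]) (a+b-b≡a (+ toℕ t) s)
        (≡[mod]-+ (≡[mod]-trans (∣ᵤ⇒≡[mod] (+ toℕ t +ᶻ s) _ t+s≡x)
                    (subst (λ r → + r ≡ x [mod n ]) (sym (FinP.toℕ-fromℕ< _)) (%ℕ-≡[mod] x)))
          (≡[mod]-refl {x = ℤ.- s})))
      y∈ : x -ᶻ s ∈ map (progression c n (+ toℕ t)) (upTo m)
      y∈ = ∈-progression c≤y y<c+mn y≡t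

-- X N and Y n stand for k τ(S, N) and k τ(S, ℤ_n), with c = k; the limits use nothing else about them.

record TauBounds (X Y : ℕ → ℕ) (d c : ℕ) : Set where
  field
    mono          : ∀ {N N′} → 1 ≤ N → N ≤ N′ → X N ≤ X N′
    subadditive   : ∀ {N L} → 1 ≤ N → 1 ≤ L → X (N + L) ≤ X N + X L
    superadditive : ∀ {N L} → 1 ≤ N → 1 ≤ L → X N + X L ≤ X (N + L) + d * c
    linear        : ∀ {N} → 1 ≤ N → X N ≤ N * c
    cyclic≤       : ∀ {n} → d < n → Y n ≤ X n
    lift          : ∀ {n m} → d < n → 1 ≤ m → X (m * n ∸ d) ≤ m * Y n

scale : ∀ {X Y d c} → TauBounds X Y d c → ∀ k → TauBounds (λ N → X N * k) (λ n → Y n * k) d (c * k)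
scale {X} {Y} {d} {c} B k = record
  { mono          = λ 1≤N N≤N′ → *k (mono 1≤N N≤N′)
  ; subadditive   = λ {N} {L} 1≤N 1≤L →
      ℕP.≤-trans (*k (subadditive 1≤N 1≤L)) (ℕP.≤-reflexive (ℕP.*-distribʳ-+ k (X N) (X L)))
  ; superadditive = λ {N} {L} 1≤N 1≤L → subst₂ _≤_ (ℕP.*-distribʳ-+ k (X N) (X L))
      (trans (ℕP.*-distribʳ-+ k (X (N + L)) (d * c)) (cong (λ v → X (N + L) * k + v) (ℕP.*-assoc d c k)))
      (*k (superadditive 1≤N 1≤L))
  ; linear        = λ {N} 1≤N → ℕP.≤-trans (*k (linear 1≤N)) (ℕP.≤-reflexive (ℕP.*-assoc N c k))
  ; cyclic≤       = λ d<n → *k (cyclic≤ d<n)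
  ; lift          = λ {n} {m} d<n 1≤m → ℕP.≤-trans (*k (lift d<n 1≤m)) (ℕP.≤-reflexive (ℕP.*-assoc m (Y n) k))
  }
  where
  open TauBounds B
  *k : ∀ {a b} → a ≤ b → a * k ≤ b * k
  *k = ℕP.*-monoˡ-≤ k

-- Rational estimates with cleared denominators

infix 4 _/_≤_/_+_/_

record _/_≤_/_+_/_ (a b c e j K : ℕ) : Set where
  constructor cleared
  field denominators-cleared : a * e * K ≤ c * b * K + j * (b * e)

module _ where
  open ℕP.≤-Reasoning

  /≤/+/-intro : ∀ {a b c e j K} R → e * a ≤ b * c + R → R * K ≤ j * (b * e) → a / b ≤ c / e + j / K
  /≤/+/-intro {a} {b} {c} {e} {j} {K} R ea≤bc+R RK≤jbe = cleared (begin
    a * e * K            ≡⟨ ℕ-Solver.solve (a ∷ e ∷ K ∷ []) ⟩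
    (e * a) * K          ≤⟨ ℕP.*-monoˡ-≤ K ea≤bc+R ⟩
    (b * c + R) * K      ≡⟨ ℕ-Solver.solve (b ∷ c ∷ R ∷ K ∷ []) ⟩
    c * b * K + R * K    ≤⟨ ℕP.+-monoʳ-≤ (c * b * K) RK≤jbe ⟩
    c * b * K + j * (b * e) ∎)

  ≤⇒/≤/+0/ : ∀ {a c} b K → a ≤ c → a / b ≤ c / b + 0 / K
  ≤⇒/≤/+0/ {a} {c} b K a≤c = cleared (ℕP.≤-trans (ℕP.*-monoˡ-≤ K (ℕP.*-monoˡ-≤ b a≤c)) (ℕP.m≤m+n (c * b * K) 0))

  /≤/+/-trans : ∀ {a b c e f g i j K} .{{_ : ℕ.NonZero e}} →
    a / b ≤ c / e + i / K → c / e ≤ f / g + j / K → a / b ≤ f / g + (i + j) / K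
  /≤/+/-trans {a} {b} {c} {e} {f} {g} {i} {j} {K} (cleared ab≤ce) (cleared ce≤fg) = cleared (ℕP.*-cancelˡ-≤ e (begin
    e * (a * g * K)                      ≡⟨ ℕ-Solver.solve (e ∷ a ∷ g ∷ K ∷ []) ⟩
    g * (a * e * K)                      ≤⟨ ℕP.*-monoʳ-≤ g ab≤ce ⟩
    g * (c * b * K + i * (b * e))        ≡⟨ ℕ-Solver.solve (g ∷ c ∷ b ∷ K ∷ i ∷ e ∷ []) ⟩
    b * (c * g * K) + i * (b * e * g)    ≤⟨ ℕP.+-monoˡ-≤ _ (ℕP.*-monoʳ-≤ b ce≤fg) ⟩
    b * (f * e * K + j * (e * g)) + i * (b * e * g) ≡⟨ ℕ-Solver.solve (b ∷ f ∷ e ∷ K ∷ j ∷ g ∷ i ∷ []) ⟩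
    e * (f * b * K + (i + j) * (b * g))  ∎))

  /≤/+/-weaken : ∀ {a b c e j K K₀} .{{_ : ℕ.NonZero K}} →
    a / b ≤ c / e + j / K → j * K₀ ≤ K → a / b ≤ c / e + 1 / K₀
  /≤/+/-weaken {a} {b} {c} {e} {j} {K} {K₀} (cleared ab≤ce) jK₀≤K = cleared (ℕP.*-cancelˡ-≤ K (begin
    K * (a * e * K₀)                     ≡⟨ ℕ-Solver.solve (K ∷ a ∷ e ∷ K₀ ∷ []) ⟩
    K₀ * (a * e * K)                     ≤⟨ ℕP.*-monoʳ-≤ K₀ ab≤ce ⟩
    K₀ * (c * b * K + j * (b * e))       ≡⟨ ℕ-Solver.solve (K₀ ∷ c ∷ b ∷ K ∷ j ∷ e ∷ []) ⟩
    K * (c * b * K₀) + (j * K₀) * (b * e) ≤⟨ ℕP.+-monoʳ-≤ (K * (c * b * K₀)) (ℕP.*-monoˡ-≤ (b * e) jK₀≤K) ⟩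
    K * (c * b * K₀) + K * (b * e)       ≡⟨ ℕ-Solver.solve (K ∷ c ∷ b ∷ K₀ ∷ e ∷ []) ⟩
    K * (c * b * K₀ + 1 * (b * e))       ∎))

  -- e/c - b/a = (b e / a c) (a/b - c/e), and b e / a c ≤ w.
  /≤/+/-reciprocal : ∀ {a b c e K} w .{{_ : ℕ.NonZero w}} →
    a / b ≤ c / e + 1 / (w * K) → b * e ≤ w * (a * c) → e / c ≤ b / a + 1 / K
  /≤/+/-reciprocal {a} {b} {c} {e} {K} w (cleared ab≤ce) be≤wac = cleared (ℕP.*-cancelˡ-≤ w (begin
    w * (e * a * K)                      ≡⟨ ℕ-Solver.solve (w ∷ e ∷ a ∷ K ∷ []) ⟩
    a * e * (w * K)                      ≤⟨ ab≤ce ⟩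
    c * b * (w * K) + 1 * (b * e)        ≡⟨ cong (λ v → c * b * (w * K) + v) (ℕP.*-identityˡ (b * e)) ⟩
    c * b * (w * K) + b * e              ≤⟨ ℕP.+-monoʳ-≤ (c * b * (w * K)) be≤wac ⟩
    c * b * (w * K) + w * (a * c)        ≡⟨ ℕ-Solver.solve (c ∷ b ∷ w ∷ K ∷ a ∷ []) ⟩
    w * (b * c * K + 1 * (c * a))        ∎))

module Asymptotics {X Y : ℕ → ℕ} {d c : ℕ} (bounds : TauBounds X Y d c) where

  open TauBounds bounds
  open ℕP.≤-Reasoning

  X-multiple≤ : ∀ q {L} → 1 ≤ L → X (suc q * L) ≤ suc q * X L
  X-multiple≤ zero {L} _ = subst₂ _≤_ (cong X (sym (ℕP.+-identityʳ L))) (sym (ℕP.+-identityʳ (X L))) ℕP.≤-refl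
  X-multiple≤ (suc q) {L} 1≤L = begin
    X (L + suc q * L)     ≤⟨ subadditive 1≤L (ℕP.≤-trans 1≤L (ℕP.m≤m+n L (q * L))) ⟩
    X L + X (suc q * L)   ≤⟨ ℕP.+-monoʳ-≤ (X L) (X-multiple≤ q 1≤L) ⟩
    X L + suc q * X L     ∎

  ≤X-multiple : ∀ q {L} → 1 ≤ L → suc q * X L ≤ X (suc q * L) + q * (d * c)
  ≤X-multiple zero {L} _ = subst₂ _≤_ (sym (ℕP.+-identityʳ (X L)))
    (trans (cong X (sym (ℕP.+-identityʳ L))) (sym (ℕP.+-identityʳ _))) ℕP.≤-refl
  ≤X-multiple (suc q) {L} 1≤L = begin
    X L + suc q * X L                         ≤⟨ ℕP.+-monoʳ-≤ (X L) (≤X-multiple q 1≤L) ⟩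
    X L + (X (suc q * L) + q * (d * c))       ≡⟨ sym (ℕP.+-assoc (X L) _ _) ⟩
    X L + X (suc q * L) + q * (d * c)         ≤⟨ ℕP.+-monoˡ-≤ _ (superadditive 1≤L (ℕP.≤-trans 1≤L (ℕP.m≤m+n L (q * L)))) ⟩
    X (L + suc q * L) + d * c + q * (d * c)   ≡⟨ ℕP.+-assoc (X (L + suc q * L)) (d * c) _ ⟩
    X (L + suc q * L) + suc q * (d * c)       ∎

  ratio-upper : ∀ {N L} → 1 ≤ N → 1 ≤ L → L * X N ≤ N * X L + L * L * c
  ratio-upper {N} {L@(suc _)} 1≤N 1≤L = begin
    L * X N                       ≤⟨ ℕP.*-monoʳ-≤ L (ℕP.≤-trans (mono 1≤N (ℕP.<⇒≤ N<[q+1]L)) (X-multiple≤ q 1≤L)) ⟩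
    L * (suc q * X L)             ≡⟨ regroup L q (X L) ⟩
    (q * L) * X L + L * X L       ≤⟨ ℕP.+-mono-≤ (ℕP.*-monoˡ-≤ (X L) (ℕDM.m/n*n≤m N L)) (ℕP.*-monoʳ-≤ L (linear 1≤L)) ⟩
    N * X L + L * (L * c)         ≡⟨ cong (λ v → N * X L + v) (sym (ℕP.*-assoc L L c)) ⟩
    N * X L + L * L * c           ∎
    where
    q : ℕ
    q = N ℕ./ L
    regroup : ∀ L q x → L * (suc q * x) ≡ (q * L) * x + L * x
    regroup = ℕ-Solver.solve-∀
    N<[q+1]L : N < suc q * L
    N<[q+1]L = subst (_< suc q * L) (sym (ℕDM.m≡m%n+[m/n]*n N L)) (ℕP.+-monoˡ-< (q * L) (ℕDM.m%n<n N L))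

  ratio-lower : ∀ {N L} → 1 ≤ N → 1 ≤ L → N * X L ≤ L * X N + L * L * c + N * (d * c)
  ratio-lower {N} {L@(suc _)} 1≤N 1≤L with N ℕ./ L in N/L≡
  ... | zero = begin
    N * X L                        ≤⟨ ℕP.*-monoʳ-≤ N (linear 1≤L) ⟩
    N * (L * c)                    ≤⟨ ℕP.*-monoˡ-≤ (L * c) (ℕP.<⇒≤ (ℕDM.m/n≡0⇒m<n {N} {L} N/L≡)) ⟩
    L * (L * c)                    ≡⟨ sym (ℕP.*-assoc L L c) ⟩
    L * L * c                      ≤⟨ ℕP.m≤n+m (L * L * c) (L * X N) ⟩
    L * X N + L * L * c            ≤⟨ ℕP.m≤m+n _ (N * (d * c)) ⟩
    L * X N + L * L * c + N * (d * c) ∎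
  ... | suc q = begin
    N * X L                              ≡⟨ cong (_* X L) N≡r+[q+1]L ⟩
    (r + suc q * L) * X L                ≡⟨ regroup₁ r q L (X L) ⟩
    r * X L + L * (suc q * X L)
      ≤⟨ ℕP.+-mono-≤ (ℕP.*-mono-≤ (ℕP.<⇒≤ (ℕDM.m%n<n N L)) (linear 1≤L))
           (ℕP.*-monoʳ-≤ L (ℕP.≤-trans (≤X-multiple q 1≤L) (ℕP.+-monoˡ-≤ _ (mono 1≤[q+1]L [q+1]L≤N)))) ⟩
    L * (L * c) + L * (X N + q * (d * c)) ≡⟨ regroup₂ L c (X N) q d ⟩
    L * X N + L * L * c + (q * L) * (d * c)
      ≤⟨ ℕP.+-monoʳ-≤ (L * X N + L * L * c) (ℕP.*-monoˡ-≤ (d * c) (ℕP.≤-trans (ℕP.m≤n+m (q * L) L) [q+1]L≤N)) ⟩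
    L * X N + L * L * c + N * (d * c)    ∎
    where
    r : ℕ
    r = N ℕ.% L
    regroup₁ : ∀ r q L x → (r + suc q * L) * x ≡ r * x + L * (suc q * x)
    regroup₁ = ℕ-Solver.solve-∀
    regroup₂ : ∀ L c x q d → L * (L * c) + L * (x + q * (d * c)) ≡ L * x + L * L * c + (q * L) * (d * c)
    regroup₂ = ℕ-Solver.solve-∀
    N≡r+[q+1]L : N ≡ r + suc q * L
    N≡r+[q+1]L = trans (ℕDM.m≡m%n+[m/n]*n N L) (cong (λ v → r + v * L) N/L≡)
    [q+1]L≤N : suc q * L ≤ N
    [q+1]L≤N = subst (suc q * L ≤_) (sym N≡r+[q+1]L) (ℕP.m≤n+m (suc q * L) r)
    1≤[q+1]L : 1 ≤ suc q * L
    1≤[q+1]L = ℕP.≤-trans 1≤L (ℕP.m≤m+n L (q * L))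

  interval-vs-cyclic : ∀ {n N} → d < n → 1 ≤ N → n * X N ≤ N * Y n + (d + n) * Y n
  interval-vs-cyclic {n@(suc _)} {N} d<n 1≤N = begin
    n * X N             ≤⟨ ℕP.*-monoʳ-≤ n (ℕP.≤-trans (mono 1≤N N≤mn-d) (lift {n} {m} d<n (s≤s z≤n))) ⟩
    n * (m * Y n)       ≡⟨ regroup n m (Y n) ⟩
    (m * n) * Y n       ≤⟨ ℕP.*-monoˡ-≤ (Y n) mn≤N+d+n ⟩
    (N + (d + n)) * Y n ≡⟨ ℕP.*-distribʳ-+ (Y n) N (d + n) ⟩
    N * Y n + (d + n) * Y n ∎
    where
    q m : ℕ
    q = (N + d) ℕ./ n
    m = suc q
    regroup : ∀ n m y → n * (m * y) ≡ (m * n) * y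
    regroup = ℕ-Solver.solve-∀
    N+d<mn : N + d < m * n
    N+d<mn = subst (_< m * n) (sym (ℕDM.m≡m%n+[m/n]*n (N + d) n)) (ℕP.+-monoˡ-< (q * n) (ℕDM.m%n<n (N + d) n))
    N≤mn-d : N ≤ m * n ∸ d
    N≤mn-d = subst (_≤ m * n ∸ d) (ℕP.m+n∸n≡m N d) (ℕP.∸-monoˡ-≤ d (ℕP.<⇒≤ N+d<mn))
    mn≤N+d+n : m * n ≤ N + (d + n)
    mn≤N+d+n = subst₂ _≤_ (ℕP.+-comm (q * n) n) (ℕP.+-assoc N d n) (ℕP.+-monoˡ-≤ n (ℕDM.m/n*n≤m (N + d) n))

  X[n∸d]≤Y : ∀ {n} → d < n → X (n ∸ d) ≤ Y n
  X[n∸d]≤Y {n} d<n = subst₂ (λ k y → X (k ∸ d) ≤ y) (ℕP.*-identityˡ n) (ℕP.*-identityˡ (Y n)) (lift {n} {1} d<n (s≤s z≤n))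

  Y≤nc : ∀ {n} → d < n → Y n ≤ n * c
  Y≤nc d<n = ℕP.≤-trans (cyclic≤ d<n) (linear (ℕP.≤-trans (s≤s z≤n) d<n))

  cyclic/≤interval/ : ∀ {n} K → d < n → Y n / n ≤ X n / n + 0 / K
  cyclic/≤interval/ {n} K d<n = ≤⇒/≤/+0/ n K (cyclic≤ d<n)

  interval/≤cyclic/ : ∀ {n N K} → d < n → 1 ≤ N → (d + n) * c * K ≤ N → X N / N ≤ Y n / n + 1 / K
  interval/≤cyclic/ {n} {N} {K} d<n 1≤N bound = /≤/+/-intro ((d + n) * Y n)
    (interval-vs-cyclic d<n 1≤N) (begin
      (d + n) * Y n * K          ≤⟨ ℕP.*-monoˡ-≤ K (ℕP.*-monoʳ-≤ (d + n) (Y≤nc d<n)) ⟩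
      (d + n) * (n * c) * K      ≡⟨ ℕ-Solver.solve (d ∷ n ∷ c ∷ K ∷ []) ⟩
      n * ((d + n) * c * K)      ≤⟨ ℕP.*-monoʳ-≤ n bound ⟩
      n * N                      ≡⟨ ℕ-Solver.solve (n ∷ N ∷ []) ⟩
      1 * (N * n)                ∎)

  interval/≤interval/ : ∀ {N L K} → 1 ≤ N → 1 ≤ L → L * c * K ≤ N → X N / N ≤ X L / L + 1 / K
  interval/≤interval/ {N} {L} {K} 1≤N 1≤L bound = /≤/+/-intro (L * L * c) (ratio-upper 1≤N 1≤L) (begin
    L * L * c * K      ≡⟨ ℕ-Solver.solve (L ∷ c ∷ K ∷ []) ⟩
    L * (L * c * K)    ≤⟨ ℕP.*-monoʳ-≤ L bound ⟩
    L * N              ≡⟨ ℕ-Solver.solve (L ∷ N ∷ []) ⟩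
    1 * (N * L)        ∎)

  interval/≥interval/ : ∀ {N L K} → 1 ≤ N → 1 ≤ L → 2 * (L * c * K) ≤ N → 2 * (d * c * K) ≤ L →
    X L / L ≤ X N / N + 1 / K
  interval/≥interval/ {N} {L} {K} 1≤N 1≤L bound bound′ =
    /≤/+/-intro (L * L * c + N * (d * c)) (ℕP.≤-trans (ratio-lower 1≤N 1≤L) (ℕP.≤-reflexive (ℕP.+-assoc (L * X N) _ _)))
      (ℕP.*-cancelˡ-≤ 2 (begin
        2 * ((L * L * c + N * (d * c)) * K)  ≡⟨ ℕ-Solver.solve (L ∷ c ∷ N ∷ d ∷ K ∷ []) ⟩
        L * (2 * (L * c * K)) + N * (2 * (d * c * K)) ≤⟨ ℕP.+-mono-≤ (ℕP.*-monoʳ-≤ L bound) (ℕP.*-monoʳ-≤ N bound′) ⟩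
        L * N + N * L                        ≡⟨ ℕ-Solver.solve (L ∷ N ∷ []) ⟩
        2 * (1 * (L * N))                    ∎))

  shifted/≤cyclic/ : ∀ {n K} → d < n → d * c * K ≤ n → X (n ∸ d) / (n ∸ d) ≤ Y n / n + 1 / K
  shifted/≤cyclic/ {n} {K} d<n bound = /≤/+/-intro (d * (m * c)) (begin
      n * X m                 ≡⟨ cong (_* X m) (sym (ℕP.m∸n+n≡m (ℕP.<⇒≤ d<n))) ⟩
      (m + d) * X m           ≡⟨ ℕP.*-distribʳ-+ (X m) m d ⟩
      m * X m + d * X m       ≤⟨ ℕP.+-mono-≤ (ℕP.*-monoʳ-≤ m (X[n∸d]≤Y d<n)) (ℕP.*-monoʳ-≤ d (linear 1≤m)) ⟩
      m * Y n + d * (m * c)   ∎) (begin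
      d * (m * c) * K         ≡⟨ regroup d m c K ⟩
      m * (d * c * K)         ≤⟨ ℕP.*-monoʳ-≤ m bound ⟩
      m * n                   ≡⟨ sym (ℕP.*-identityˡ (m * n)) ⟩
      1 * (m * n)             ∎)
    where
    m : ℕ
    m = n ∸ d
    regroup : ∀ d m c K → d * (m * c) * K ≡ m * (d * c * K)
    regroup = ℕ-Solver.solve-∀
    1≤m : 1 ≤ m
    1≤m = ℕP.m<n⇒0<n∸m d<n

  -- Both estimates pass through X L / L for a fixed large L; the upper bound on X N / N also passes
  -- through X (n - d) / (n - d), which is at most Y n / (n - d).
  module Threshold (K : ℕ) where

    K′ dcK′ L LcK′ : ℕ
    K′ = 3 * suc K
    dcK′ = d * c * K′
    L = suc (2 * dcK′)
    LcK′ = L * c * K′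

    threshold : ℕ
    threshold = suc (2 * LcK′ + 2 * d + dcK′)

    d<threshold : d < threshold
    d<threshold = s≤s (ℕP.≤-trans (ℕP.m≤n+m d (2 * LcK′ + d)) (ℕP.≤-trans (ℕP.≤-reflexive (ℕP.+-assoc (2 * LcK′) d d))
      (ℕP.≤-trans (ℕP.+-monoʳ-≤ (2 * LcK′) (ℕP.+-monoʳ-≤ d (ℕP.m≤m+n d 0))) (ℕP.m≤m+n (2 * LcK′ + 2 * d) dcK′))))

    2d≤threshold : 2 * d ≤ threshold
    2d≤threshold = ℕP.m≤n⇒m≤1+n (ℕP.≤-trans (ℕP.m≤n+m (2 * d) (2 * LcK′)) (ℕP.m≤m+n (2 * LcK′ + 2 * d) dcK′))

    module _ {n} (t≤n : threshold ≤ n) where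

      2LcK′+d<n : 2 * LcK′ + d < n
      2LcK′+d<n = ℕP.<-≤-trans
        (s≤s (ℕP.≤-trans (ℕP.+-monoʳ-≤ (2 * LcK′) (ℕP.m≤m+n d (d + 0))) (ℕP.m≤m+n (2 * LcK′ + 2 * d) dcK′))) t≤n

      2LcK′≤n : 2 * LcK′ ≤ n
      2LcK′≤n = ℕP.≤-trans (ℕP.m≤m+n (2 * LcK′) d) (ℕP.<⇒≤ 2LcK′+d<n)

      LcK′≤n : LcK′ ≤ n
      LcK′≤n = ℕP.≤-trans (ℕP.m≤m+n LcK′ _) 2LcK′≤n

      dcK′≤n : dcK′ ≤ n
      dcK′≤n = ℕP.≤-trans (ℕP.m≤n⇒m≤1+n (ℕP.m≤n+m dcK′ (2 * LcK′ + 2 * d))) t≤n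

      1≤n : 1 ≤ n
      1≤n = ℕP.≤-trans (s≤s z≤n) t≤n

    2dcK′≤L : 2 * dcK′ ≤ L
    2dcK′≤L = ℕP.n≤1+n (2 * dcK′)

    cyclic-below : ∀ {n N} → threshold ≤ n → threshold ≤ N → Y n / n ≤ X N / N + 1 / suc K
    cyclic-below {n@(suc _)} {N} t≤n t≤N = /≤/+/-weaken {K = K′}
      (/≤/+/-trans (/≤/+/-trans (cyclic/≤interval/ K′ (ℕP.<-≤-trans d<threshold t≤n))
        (interval/≤interval/ (1≤n t≤n) (s≤s z≤n) (LcK′≤n t≤n)))
        (interval/≥interval/ (1≤n t≤N) (s≤s z≤n) (2LcK′≤n t≤N) 2dcK′≤L))
      (ℕP.*-monoˡ-≤ (suc K) (ℕP.n≤1+n 2))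

    cyclic-above : ∀ {n N} → threshold ≤ n → threshold ≤ N → X N / N ≤ Y n / n + 1 / suc K
    cyclic-above {n} {N} t≤n t≤N = /≤/+/-weaken {K = K′}
      (/≤/+/-trans {{ℕ.>-nonZero 1≤m}} (/≤/+/-trans (interval/≤interval/ (1≤n t≤N) (s≤s z≤n) (LcK′≤n t≤N))
        (interval/≥interval/ 1≤m (s≤s z≤n) 2LcK′≤m 2dcK′≤L))
        (shifted/≤cyclic/ d<n (dcK′≤n t≤n)))
      ℕP.≤-refl
      where
      d<n : d < n
      d<n = ℕP.<-≤-trans d<threshold t≤n
      1≤m : 1 ≤ n ∸ d
      1≤m = ℕP.m<n⇒0<n∸m d<n
      2LcK′≤m : (2 * LcK′) ≤ n ∸ d
      2LcK′≤m = subst (_≤ n ∸ d) (ℕP.m+n∸n≡m (2 * LcK′) d) (ℕP.∸-monoˡ-≤ d (ℕP.<⇒≤ (2LcK′+d<n t≤n)))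

private
  _/suc_ : ℕ → ℕ → ℚᵘ
  a /suc b = mkℚᵘ (+ a) b

  toℚᵘ-// : ∀ a b → ℚ.toℚᵘ (a // suc b) ℚᵘ.≃ a /suc b
  toℚᵘ-// a b = ℚP.toℚᵘ-fromℚᵘ (a /suc b)

/≤/+/⇒≤ℚ : ∀ {a b c e j K} → 1 ≤ b → 1 ≤ e → a / b ≤ c / e + j / suc K → a // b ≤ℚ c // e +ℚ j // suc K
/≤/+/⇒≤ℚ {a} {suc b} {c} {suc e} {j} {K} _ _ (cleared ab≤ce) =
  ℚP.toℚᵘ-cancel-≤ (ℚᵘP.≤-respʳ-≃ (ℚᵘP.≃-sym sum≃)
    (ℚᵘP.≤-respˡ-≃ (ℚᵘP.≃-sym (toℚᵘ-// a b)) (*≤* (subst₂ _≤ᶻ_ lhs rhs (ℤ.+≤+ ab≤ce)))))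
  where
  sum≃ : ℚ.toℚᵘ (c // suc e +ℚ j // suc K) ℚᵘ.≃ c /suc e ℚᵘ.+ j /suc K
  sum≃ = ℚᵘP.≃-trans (ℚP.toℚᵘ-homo-+ (c // suc e) (j // suc K)) (ℚᵘP.+-cong (toℚᵘ-// c e) (toℚᵘ-// j K))
  lhs : + (a * suc e * suc K) ≡ + a *ᶻ + (suc e * suc K)
  lhs = trans (cong +_ (ℕP.*-assoc a (suc e) (suc K))) (ℤP.pos-* a (suc e * suc K))
  rhs : + (c * suc b * suc K + j * (suc b * suc e)) ≡ (+ c *ᶻ + suc K +ᶻ + j *ᶻ + suc e) *ᶻ + suc b
  rhs = begin
    + (c * suc b * suc K + j * (suc b * suc e))       ≡⟨ cong +_ (ℕ-Solver.solve (c ∷ b ∷ K ∷ j ∷ e ∷ [])) ⟩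
    + ((c * suc K + j * suc e) * suc b)               ≡⟨ ℤP.pos-* (c * suc K + j * suc e) (suc b) ⟩
    + (c * suc K + j * suc e) *ᶻ + suc b              ≡⟨ cong (_*ᶻ + suc b) (ℤP.pos-+ (c * suc K) (j * suc e)) ⟩
    (+ (c * suc K) +ᶻ + (j * suc e)) *ᶻ + suc b
      ≡⟨ cong (_*ᶻ + suc b) (cong₂ _+ᶻ_ (ℤP.pos-* c (suc K)) (ℤP.pos-* j (suc e))) ⟩
    (+ c *ᶻ + suc K +ᶻ + j *ᶻ + suc e) *ᶻ + suc b     ∎
    where open ≡-Reasoning

1//suc<ε : ∀ {ε} → 0ℚ <ℚ ε → ∃ λ K → 1 // suc K <ℚ ε
1//suc<ε {mkℚ (+ zero) _ _} (ℚ.*<* (ℤ.+<+ ()))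
1//suc<ε {mkℚ -[1+ _ ] _ _} (ℚ.*<* ())
1//suc<ε {mkℚ (+ suc p) q _} _ = suc q , ℚP.toℚᵘ-cancel-< (ℚᵘP.<-respˡ-≃ (ℚᵘP.≃-sym (toℚᵘ-// 1 (suc q)))
  (*<* (subst₂ _<ᶻ_ (ℤP.pos-* 1 (suc q)) (ℤP.pos-* (suc p) (suc (suc q)))
    (ℤ.+<+ (ℕP.<-≤-trans (ℕP.≤-reflexive (cong suc (ℕP.*-identityˡ (suc q)))) (ℕP.m≤n*m (suc (suc q)) (suc p)))))))

≤+1//suc⇒<+ : ∀ {x y ε K} → x ≤ℚ y +ℚ 1 // suc K → 1 // suc K <ℚ ε → x <ℚ y +ℚ ε
≤+1//suc⇒<+ {y = y} x≤y+δ δ<ε = ℚP.≤-<-trans x≤y+δ (ℚP.+-monoʳ-< y δ<ε)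

private
  open +-*-Solver using (_:+_; :-_; _:=_)
  y+ε-y≡ε : ∀ y ε → (y +ℚ ε) +ℚ ℚ.- y ≡ ε
  y+ε-y≡ε = +-*-Solver.solve 2 (λ y ε → (y :+ ε) :+ (:- y) := ε) refl
  -[x-y]≡y-x : ∀ x y → ℚ.- (x -ℚ y) ≡ y -ℚ x
  -[x-y]≡y-x = +-*-Solver.solve 2 (λ x y → :- (x :+ (:- y)) := y :+ (:- x)) refl

<+∧<+⇒∣-∣< : ∀ {x y ε} → x <ℚ y +ℚ ε → y <ℚ x +ℚ ε → ℚ.∣ x -ℚ y ∣ <ℚ ε
<+∧<+⇒∣-∣< {x} {y} {ε} x<y+ε y<x+ε with ℚP.∣p∣≡p∨∣p∣≡-p (x -ℚ y)
... | inj₁ ∣x-y∣≡x-y = subst (_<ℚ ε) (sym ∣x-y∣≡x-y)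
  (subst (x -ℚ y <ℚ_) (y+ε-y≡ε y ε) (ℚP.+-monoˡ-< (ℚ.- y) x<y+ε))
... | inj₂ ∣x-y∣≡y-x = subst (_<ℚ ε) (sym (trans ∣x-y∣≡y-x (-[x-y]≡y-x x y)))
  (subst (y -ℚ x <ℚ_) (y+ε-y≡ε x ε) (ℚP.+-monoˡ-< (ℚ.- x) y<x+ε))

LimLe-intro : ∀ (b : ℕ → ℚ) q → (∀ K → ∃ λ M → ∀ N → M ≤ N → b N ≤ℚ q +ℚ 1 // suc K) → LimLe b q
LimLe-intro b q close ε 0<ε =
  let K , δ<ε = 1//suc<ε 0<ε ; M , near = close K in
  M , λ N M≤N → ℚP.<⇒≤ (≤+1//suc⇒<+ {y = q} {K = K} (near N M≤N) δ<ε)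

LimGe-intro : ∀ (b : ℕ → ℚ) q → (∀ K → ∃ λ M → ∀ N → M ≤ N → q ≤ℚ b N +ℚ 1 // suc K) → LimGe b q
LimGe-intro b q close ε 0<ε =
  let K , δ<ε = 1//suc<ε 0<ε ; M , near = close K in
  M , λ N M≤N → ℚP.<⇒≤ (≤+1//suc⇒<+ {y = b N} {K = K} (near N M≤N) δ<ε)

SameLim-intro : ∀ (a b : ℕ → ℚ) → (∀ K → ∃ λ M → ∀ n N → M ≤ n → M ≤ N →
  a n ≤ℚ b N +ℚ 1 // suc K × b N ≤ℚ a n +ℚ 1 // suc K) → SameLim a b
SameLim-intro a b close ε 0<ε =
  let K , δ<ε = 1//suc<ε 0<ε ; M , near = close K in
  M , λ n N M≤n M≤N → let below , above = near n N M≤n M≤N in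
    <+∧<+⇒∣-∣< (≤+1//suc⇒<+ {y = b N} {K = K} below δ<ε) (≤+1//suc⇒<+ {y = a n} {K = K} above δ<ε)

InfApprox-intro : ∀ d (a b : ℕ → ℚ) →
  (∀ K → ∃ λ M → d < M × ∀ N → M ≤ N → a M ≤ℚ b N +ℚ 1 // suc K) → InfApprox d a b
InfApprox-intro d a b close ε 0<ε =
  let K , δ<ε = 1//suc<ε 0<ε ; M , d<M , near = close K in
  M , d<M , M , λ N M≤N → ≤+1//suc⇒<+ {y = b N} {K = K} (near N M≤N) δ<ε

SupApprox-intro : ∀ d (a b : ℕ → ℚ) →
  (∀ K → ∃ λ M → d < M × ∀ N → M ≤ N → b N ≤ℚ a M +ℚ 1 // suc K) → SupApprox d a b
SupApprox-intro d a b close ε 0<ε =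
  let K , δ<ε = 1//suc<ε 0<ε ; M , d<M , near = close K in
  M , d<M , M , λ N M≤N → ≤+1//suc⇒<+ {y = a M} {K = K} (near N M≤N) δ<ε

//-monoˡ-≤ : ∀ {a c} b → 1 ≤ b → a ≤ c → a // b ≤ℚ c // b
//-monoˡ-≤ {a} {c} (suc b) _ a≤c = ℚP.toℚᵘ-cancel-≤ (ℚᵘP.≤-respʳ-≃ (ℚᵘP.≃-sym (toℚᵘ-// c b))
  (ℚᵘP.≤-respˡ-≃ (ℚᵘP.≃-sym (toℚᵘ-// a b))
    (*≤* (subst₂ _≤ᶻ_ (ℤP.pos-* a (suc b)) (ℤP.pos-* c (suc b)) (ℤ.+≤+ (ℕP.*-monoˡ-≤ (suc b) a≤c))))))

module Limits {X Y : ℕ → ℕ} {d c : ℕ} (bounds : TauBounds X Y d c) where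

  open TauBounds bounds using (cyclic≤)
  open Asymptotics bounds

  cyclic≤interval : ∀ {n} → d < n → Y n // n ≤ℚ X n // n
  cyclic≤interval d<n = //-monoˡ-≤ _ (ℕP.≤-trans (s≤s z≤n) d<n) (cyclic≤ d<n)

  limLe : ∀ {n} → d < n → LimLe (λ N → X N // N) (Y n // n)
  limLe {n} d<n = LimLe-intro (λ N → X N // N) (Y n // n) λ K →
    suc ((d + n) * c * suc K) , λ N M≤N →
      let 1≤N = ℕP.≤-trans (s≤s z≤n) M≤N in
      /≤/+/⇒≤ℚ 1≤N (ℕP.≤-trans (s≤s z≤n) d<n) (interval/≤cyclic/ d<n 1≤N (ℕP.≤-trans (ℕP.n≤1+n _) M≤N))

  sameLim : SameLim (λ n → Y n // n) (λ N → X N // N)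
  sameLim = SameLim-intro (λ n → Y n // n) (λ N → X N // N) λ K → let open Threshold K in
    threshold , λ n N t≤n t≤N →
      /≤/+/⇒≤ℚ (1≤n t≤n) (1≤n t≤N) (cyclic-below t≤n t≤N) , /≤/+/⇒≤ℚ (1≤n t≤N) (1≤n t≤n) (cyclic-above t≤n t≤N)

  infApprox : InfApprox d (λ n → Y n // n) (λ N → X N // N)
  infApprox = InfApprox-intro d (λ n → Y n // n) (λ N → X N // N) λ K → let open Threshold K in
    threshold , d<threshold , λ N t≤N → /≤/+/⇒≤ℚ (1≤n ℕP.≤-refl) (1≤n t≤N) (cyclic-below ℕP.≤-refl t≤N)

module ReciprocalLimits {X Y : ℕ → ℕ} {d c : ℕ} (bounds : TauBounds X Y d c) (≤X : ∀ {N} → 1 ≤ N → N ≤ X N) where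

  open Asymptotics bounds

  n∸d≤Y : ∀ {n} → d < n → n ∸ d ≤ Y n
  n∸d≤Y d<n = ℕP.≤-trans (≤X (ℕP.m<n⇒0<n∸m d<n)) (X[n∸d]≤Y d<n)

  1≤Y : ∀ {n} → d < n → 1 ≤ Y n
  1≤Y d<n = ℕP.≤-trans (ℕP.m<n⇒0<n∸m d<n) (n∸d≤Y d<n)

  N*n≤2XY : ∀ {N n} → 1 ≤ N → d < n → 2 * d ≤ n → N * n ≤ 2 * (X N * Y n)
  N*n≤2XY {N} {n} 1≤N d<n 2d≤n = begin
    N * n                 ≤⟨ ℕP.*-mono-≤ (≤X 1≤N) n≤2Y ⟩
    X N * (2 * Y n)       ≡⟨ regroup (X N) (Y n) ⟩
    2 * (X N * Y n)       ∎
    where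
    open ℕP.≤-Reasoning
    regroup : ∀ x y → x * (2 * y) ≡ 2 * (x * y)
    regroup = ℕ-Solver.solve-∀
    d≤n∸d : d ≤ n ∸ d
    d≤n∸d = ℕP.m+n≤o⇒m≤o∸n d (ℕP.≤-trans (ℕP.+-monoʳ-≤ d (ℕP.m≤m+n d 0)) 2d≤n)
    n≤2Y : n ≤ 2 * Y n
    n≤2Y = begin
      n                   ≡⟨ sym (ℕP.m∸n+n≡m (ℕP.<⇒≤ d<n)) ⟩
      n ∸ d + d           ≤⟨ ℕP.+-mono-≤ (n∸d≤Y d<n) (ℕP.≤-trans d≤n∸d (n∸d≤Y d<n)) ⟩
      Y n + Y n           ≡⟨ cong (λ v → Y n + v) (sym (ℕP.+-identityʳ (Y n))) ⟩
      2 * Y n             ∎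

  1≤X : ∀ {N} → 1 ≤ N → 1 ≤ X N
  1≤X 1≤N = ℕP.≤-trans 1≤N (≤X 1≤N)

  n*N≤2YX : ∀ {N n} → 1 ≤ N → d < n → 2 * d ≤ n → n * N ≤ 2 * (Y n * X N)
  n*N≤2YX {N} {n} 1≤N d<n 2d≤n =
    subst₂ _≤_ (ℕP.*-comm N n) (cong (2 *_) (ℕP.*-comm (X N) (Y n))) (N*n≤2XY 1≤N d<n 2d≤n)

  -- Threshold (pred (2 * suc K)) bounds the errors by 1 / (2 (K + 1)); inversion at most doubles them.
  sameLim : SameLim (λ n → n // Y n) (λ N → N // X N)
  sameLim = SameLim-intro (λ n → n // Y n) (λ N → N // X N) λ K → let open Threshold (pred (2 * suc K)) in
    threshold , λ n N t≤n t≤N →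
      let d<n = ℕP.<-≤-trans d<threshold t≤n
          2d≤n = ℕP.≤-trans 2d≤threshold t≤n
          1≤N = 1≤n t≤N
      in /≤/+/⇒≤ℚ (1≤Y d<n) (1≤X 1≤N) (/≤/+/-reciprocal 2 (cyclic-above t≤n t≤N) (N*n≤2XY 1≤N d<n 2d≤n))
       , /≤/+/⇒≤ℚ (1≤X 1≤N) (1≤Y d<n) (/≤/+/-reciprocal 2 (cyclic-below t≤n t≤N) (n*N≤2YX 1≤N d<n 2d≤n))

  supApprox : SupApprox d (λ n → n // Y n) (λ N → N // X N)
  supApprox = SupApprox-intro d (λ n → n // Y n) (λ N → N // X N) λ K → let open Threshold (pred (2 * suc K)) in
    threshold , d<threshold , λ N t≤N →
      let 1≤N = 1≤n t≤N in
      /≤/+/⇒≤ℚ (1≤X 1≤N) (1≤Y d<threshold)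
        (/≤/+/-reciprocal 2 (cyclic-below ℕP.≤-refl t≤N) (n*N≤2YX 1≤N d<threshold 2d≤threshold))

  limGe : ∀ {n} → d < n → LimGe (λ N → N // X N) (n // Y n)
  limGe {n@(suc _)} d<n = LimGe-intro (λ N → N // X N) (n // Y n) λ K →
    suc ((d + n) * c * (n * suc K)) , λ N M≤N →
      let 1≤N = ℕP.≤-trans (s≤s z≤n) M≤N in
      /≤/+/⇒≤ℚ (1≤Y d<n) (1≤X 1≤N)
        (/≤/+/-reciprocal n (interval/≤cyclic/ d<n 1≤N (ℕP.≤-trans (ℕP.n≤1+n _) M≤N)) (N*n≤n*XY 1≤N))
    where
    open ℕP.≤-Reasoning
    N*n≤n*XY : ∀ {N} → 1 ≤ N → N * n ≤ n * (X N * Y n)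
    N*n≤n*XY {N} 1≤N = begin
      N * n                ≤⟨ ℕP.*-monoˡ-≤ n (ℕP.≤-trans (≤X 1≤N) (ℕP.m≤m*n (X N) (Y n) {{ℕ.>-nonZero (1≤Y d<n)}})) ⟩
      X N * Y n * n        ≡⟨ ℕP.*-comm (X N * Y n) n ⟩
      n * (X N * Y n)      ∎

lemma6p1 : (S : FinSetℤ) → (tN tZ : ℕ → ℕ)
    → ((N : ℕ) → 1 ≤ N → IsTauN S N (tN N))
    → ((n : ℕ) → diam S < n → IsTauZn S n (tZ n))
    → let d = diam S
          k = card S
          τN : ℕ → ℚ
          τN N = tN N // N
          τZn : ℕ → ℚ
          τZn n = tZ n // n
          κN : ℕ → ℚ
          κN N = (tN N * k) // N
          κZn : ℕ → ℚ
          κZn n = (tZ n * k) // n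
          eN : ℕ → ℚ
          eN N = N // (tN N * k)
          eZn : ℕ → ℚ
          eZn n = n // (tZ n * k)
      in ((n : ℕ) → d < n →
            (LimLe τN (τZn n) × τZn n ≤ℚ τN n)
            × (LimLe κN (κZn n) × κZn n ≤ℚ κN n)
            × ((m : ℕ) → 1 ≤ m → tN (m * n ∸ d) ≤ m * tZ n))
         × (SameLim τZn τN × InfApprox d τZn τN)
         × (SameLim κZn κN × InfApprox d κZn κN)
         × (SameLim eZn eN × ((n : ℕ) → d < n → LimGe eN (eZn n))
            × SupApprox d eZn eN)
lemma6p1 S tN tZ isTau isTauₙ =
    (λ n d<n → (τ.limLe d<n , τ.cyclic≤interval d<n) , (κ.limLe d<n , κ.cyclic≤interval d<n) , λ m → τ-lift d<n)
  , (τ.sameLim , τ.infApprox)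
  , (κ.sameLim , κ.infApprox)
  , (e.sameLim , (λ n → e.limGe) , e.supApprox)
  where
  open TauInterval S tN isTau
  open TauCyclic S tN tZ isTau isTauₙ
  τ-bounds : TauBounds tN tZ d 1
  τ-bounds = record
    { mono          = τ-mono
    ; subadditive   = τ-subadditive
    ; superadditive = λ 1≤N 1≤L → subst (λ v → _ ≤ _ + v) (sym (ℕP.*-identityʳ d)) (τ-superadditive 1≤N 1≤L)
    ; linear        = λ {N} 1≤N → subst (tN N ≤_) (sym (ℕP.*-identityʳ N)) (τ≤N 1≤N)
    ; cyclic≤       = τₙ≤τ
    ; lift          = τ-lift
    }
  module τ = Limits τ-bounds
  module κ = Limits (scale τ-bounds (card S))
  module e = ReciprocalLimits (scale τ-bounds (card S)) N≤τ*card
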